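{- Let $G$ be an acyclic digraph. Let $s,t \in V(G)$ be such that $(s,t) \notin E(G)$ and $G+(s,t)$ is acyclic. Then for every vertex $v \in V(G)$: $$R_{G+(s,t)}(v) \setminus R_G(v) = \begin{cases} R_\bigtriangleup \setminus \bigcup_{b \in R_G(v)\cap B} R_G(b) & \text{if } v \in R^\bigtriangledown,\\ \emptyset & \text{otherwise.}\end{cases}$$
   Context: All digraphs are simple. $G+(s,t)$ denotes the digraph $(V(G), E(G)\cup\{(s,t)\})$. For a digraph $H$ and a vertex $v$, $R_H(v)$ is the set of vertices reachable from $v$ by a directed path in $H$, including $v$. Define $R^\bigtriangledown$ as the set of vertices of $G$ that can reach $s$ in $G$, and $R_\bigtriangleup = R_G(t)$. A vertex $b \in R^\bigtriangledown$ is a boundary if there exist a vertex $c \in R_\bigtriangleup$ and a directed path in $G$ from $b$ to $c$ that does not use the edge $(s,t)$ and none of whose internal vertices lies in $R^\bigtriangledown$. $B \subseteq R^\bigtriangledown$ denotes the set of all boundaries. -}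

module Defs where

open import Data.Nat using (ℕ)
open import Data.Fin using (Fin; _≟_)
open import Data.Bool using (Bool; true; false; _∨_; _∧_)
open import Data.Product using (_×_; ∃-syntax)
open import Relation.Nullary using (¬_)
open import Relation.Nullary.Decidable using (⌊_⌋)
open import Relation.Binary.PropositionalEquality using (_≡_)

-- A finite digraph on vertex set Fin n, given by its adjacency matrix:
-- (u , v) is an edge iff  G u v ≡ true.  (A relation, so no multi-edges.)
Digraph : ℕ → Set
Digraph n = Fin n → Fin n → Bool

module _ {n : ℕ} where

  Edge : Digraph n → Fin n → Fin n → Set
  Edge G u v = G u v ≡ true

  addEdge : Digraph n → Fin n → Fin n → Digraph n
  addEdge G s t u v = G u v ∨ (⌊ u ≟ s ⌋ ∧ ⌊ v ≟ t ⌋)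

  data Walk (G : Digraph n) : Fin n → Fin n → Set where
    []  : ∀ {u} → Walk G u u
    _∷_ : ∀ {u v w} → Edge G u v → Walk G v w → Walk G u w

  Reach : Digraph n → Fin n → Fin n → Set
  Reach G v w = Walk G v w

  Acyclic : Digraph n → Set
  Acyclic G = ∀ u v → Edge G u v → ¬ Reach G v u

  data WalkVia (G : Digraph n) (Q : Fin n → Set) : Fin n → Fin n → Set where
    []   : ∀ {u} → WalkVia G Q u u
    edge : ∀ {u v} → Edge G u v → WalkVia G Q u v
    step : ∀ {u v w} → Edge G u v → Q v → WalkVia G Q v w → WalkVia G Q u w

  RDown : Digraph n → Fin n → Fin n → Set
  RDown G s x = Reach G x s

  RUp : Digraph n → Fin n → Fin n → Set
  RUp G t x = Reach G t x

  Boundary : Digraph n → Fin n → Fin n → Fin n → Set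
  Boundary G s t b =
    RDown G s b × ∃[ c ] (RUp G t c × WalkVia G (λ x → ¬ RDown G s x) b c)

{-# OPTIONS --safe #-}
-- A walk in G + (s,t) that is not a walk of G uses the new edge: before its
-- first use it shows v ∈ R^▽, after its last use w ∈ R_△.  Conversely every
-- w ∈ R_△ is reached through s → t from any v ∈ R^▽, and a G-walk from v to w
-- is split at its last vertex in R^▽, which is then a boundary reaching w.
module Submission where

open import Defs
open import Data.Nat using (ℕ)
open import Data.Fin using (Fin; _≟_)
open import Data.Bool using (true; false; _∨_)
open import Data.Bool.Properties using (∨-zeroʳ)
open import Data.Product using (_×_; ∃-syntax; _,_)
open import Data.Sum using (_⊎_; inj₁; inj₂)
open import Relation.Nullary using (¬_; yes; no; contradiction)
open import Relation.Nullary.Decidable using (¬¬-excluded-middle)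
open import Relation.Binary.PropositionalEquality using (_≡_; refl; cong)
open import Function.Bundles using (_⇔_; mk⇔)

module _ {n : ℕ} where

  _++ᵂ_ : ∀ {H : Digraph n} {u v w} → Walk H u v → Walk H v w → Walk H u w
  []      ++ᵂ q = q
  (e ∷ p) ++ᵂ q = e ∷ (p ++ᵂ q)

  Walk-map : ∀ {H H′ : Digraph n} → (∀ {u v} → Edge H u v → Edge H′ u v)
           → ∀ {u w} → Walk H u w → Walk H′ u w
  Walk-map f []      = []
  Walk-map f (e ∷ p) = f e ∷ Walk-map f p

  WalkVia⇒Walk : ∀ {H : Digraph n} {Q u w} → WalkVia H Q u w → Walk H u w
  WalkVia⇒Walk []           = []
  WalkVia⇒Walk (edge e)     = e ∷ []
  WalkVia⇒Walk (step e _ p) = e ∷ WalkVia⇒Walk p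

  LastVisit : Digraph n → (Fin n → Set) → Fin n → Fin n → Set
  LastVisit H P u w = ∃[ b ] (Walk H u b × P b × WalkVia H (λ x → ¬ P x) b w)

  -- P need not be decidable: the excluded middle is only used under ¬ ¬.
  ¬¬-lastVisit⊎avoid : ∀ {H : Digraph n} (P : Fin n → Set) {u w} → Walk H u w
                     → ¬ ¬ (LastVisit H P u w ⊎ WalkVia H (λ x → ¬ P x) u w)
  ¬¬-lastVisit⊎avoid P []                    k = k (inj₂ [])
  ¬¬-lastVisit⊎avoid P (_∷_ {v = v} e p) k = ¬¬-lastVisit⊎avoid P p λ where
    (inj₁ (b , q , Pb , via)) → k (inj₁ (b , e ∷ q , Pb , via))
    (inj₂ via)                → ¬¬-excluded-middle λ where
      (yes Pv) → k (inj₁ (v , e ∷ [] , Pv , via))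
      (no ¬Pv) → k (inj₂ (step e ¬Pv via))

  ¬¬-lastVisit : ∀ {H : Digraph n} {P : Fin n → Set} {u w}
               → P u → Walk H u w → ¬ ¬ LastVisit H P u w
  ¬¬-lastVisit {P = P} {u} Pu p k = ¬¬-lastVisit⊎avoid P p λ where
    (inj₁ last) → k last
    (inj₂ via)  → k (u , [] , Pu , via)

module _ {n : ℕ} (G : Digraph n) (s t : Fin n) where

  private
    G⁺ : Digraph n
    G⁺ = addEdge G s t

  addEdge-old : ∀ {u v} → Edge G u v → Edge G⁺ u v
  addEdge-old e = cong (_∨ _) e

  addEdge-new : Edge G⁺ s t
  addEdge-new with s ≟ s | t ≟ t
  ... | yes _   | yes _   = ∨-zeroʳ (G s t)
  ... | no s≢s  | _       = contradiction refl s≢s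
  ... | yes _   | no t≢t  = contradiction refl t≢t

  addEdge-edge : ∀ {u v} → Edge G⁺ u v → Edge G u v ⊎ (u ≡ s × v ≡ t)
  addEdge-edge {u} {v} e with G u v | u ≟ s | v ≟ t
  ... | true  | _        | _        = inj₁ refl
  ... | false | yes u≡s  | yes v≡t  = inj₂ (u≡s , v≡t)
  addEdge-edge () | false | yes _ | no _
  addEdge-edge () | false | no _  | _

  walk⁺-old⊎afterNew : ∀ {u w} → Walk G⁺ u w → Walk G u w ⊎ Walk G t w
  walk⁺-old⊎afterNew [] = inj₁ []
  walk⁺-old⊎afterNew (e ∷ p) with walk⁺-old⊎afterNew p | addEdge-edge e
  ... | inj₂ q | _              = inj₂ q
  ... | inj₁ q | inj₁ e′        = inj₁ (e′ ∷ q)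
  ... | inj₁ q | inj₂ (_ , refl) = inj₂ q

  walk⁺-old⊎beforeNew : ∀ {u w} → Walk G⁺ u w → Walk G u w ⊎ Walk G u s
  walk⁺-old⊎beforeNew [] = inj₁ []
  walk⁺-old⊎beforeNew (e ∷ p) with addEdge-edge e
  ... | inj₂ (refl , _) = inj₂ []
  ... | inj₁ e′ with walk⁺-old⊎beforeNew p
  ...   | inj₁ q = inj₁ (e′ ∷ q)
  ...   | inj₂ q = inj₂ (e′ ∷ q)

  newReach⇒RUp : ∀ {v w} → Reach G⁺ v w → ¬ Reach G v w → RUp G t w
  newReach⇒RUp p ¬q with walk⁺-old⊎afterNew p
  ... | inj₁ q = contradiction q ¬q
  ... | inj₂ q = q

  newReach⇒RDown : ∀ {v w} → Reach G⁺ v w → ¬ Reach G v w → RDown G s v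
  newReach⇒RDown p ¬q with walk⁺-old⊎beforeNew p
  ... | inj₁ q = contradiction q ¬q
  ... | inj₂ q = q

  RDown×RUp⇒reach⁺ : ∀ {v w} → RDown G s v → RUp G t w → Reach G⁺ v w
  RDown×RUp⇒reach⁺ vs tw = Walk-map addEdge-old vs ++ᵂ (addEdge-new ∷ Walk-map addEdge-old tw)

  reach⇒viaBoundary : ∀ {v w} → RDown G s v → RUp G t w → Reach G v w
                    → ¬ ¬ (∃[ b ] (Reach G v b × Boundary G s t b × Reach G b w))
  reach⇒viaBoundary vs tw vw k = ¬¬-lastVisit vs vw λ where
    (b , vb , bs , via) → k (b , vb , (bs , _ , tw , via) , WalkVia⇒Walk via)

mainTheorem5 : {n : ℕ} (G : Digraph n) (s t : Fin n)
    → Acyclic G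
    → G s t ≡ false
    → Acyclic (addEdge G s t)
    → (v : Fin n)
    → (RDown G s v
        → ∀ w → ((Reach (addEdge G s t) v w × ¬ Reach G v w)
                 ⇔ (RUp G t w × ¬ (∃[ b ] (Reach G v b × Boundary G s t b × Reach G b w)))))
      × (¬ RDown G s v
        → ∀ w → ¬ (Reach (addEdge G s t) v w × ¬ Reach G v w))
mainTheorem5 G s t _ _ _ v =
    (λ vs w → mk⇔
      (λ (p , ¬q) → newReach⇒RUp G s t p ¬q , λ (_ , vb , _ , bw) → ¬q (vb ++ᵂ bw))
      (λ (tw , ¬viaB) → RDown×RUp⇒reach⁺ G s t vs tw , λ vw → reach⇒viaBoundary G s t vs tw vw ¬viaB))
  , (λ ¬vs w (p , ¬q) → ¬vs (newReach⇒RDown G s t p ¬q))
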